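{- Let $p \ge 5$ and $2p \le q \le \binom{p+1}{\lfloor \frac{p+1}{2} \rfloor} - 1$. Then $f(K(3,p,q)) = 2$.
   Context: $K(3,p,q)$ is the complete tripartite graph with parts of sizes $3$, $p$, $q$. A strong orientation of a graph is an orientation of all edges making the digraph strongly connected; the diameter of a strongly connected digraph is the maximum directed distance between ordered pairs of vertices. The oriented diameter $f(G)$ is the minimum diameter over all strong orientations of $G$. -}

module Defs where

open import Level using (0ℓ)
open import Data.Nat using (ℕ; zero; suc; _≤_)
open import Data.Fin using (Fin)
import Data.Fin
open import Data.Sum using (_⊎_; inj₁; inj₂)
open import Data.Product using (Σ; _×_; ∃)
open import Data.Empty using (⊥)
open import Relation.Nullary using (¬_)
open import Relation.Binary.PropositionalEquality using (_≡_)

record Graph : Set₁ where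
  field
    V   : Set
    Adj : V → V → Set

open Graph public

TriVert : ℕ → ℕ → Set
TriVert p q = Fin 3 ⊎ (Fin p ⊎ Fin q)

part : ∀ {p q} → TriVert p q → Fin 3
part (inj₁ _)        = Data.Fin.zero
part (inj₂ (inj₁ _)) = Data.Fin.suc Data.Fin.zero
part (inj₂ (inj₂ _)) = Data.Fin.suc (Data.Fin.suc Data.Fin.zero)

K3 : ℕ → ℕ → Graph
K3 p q = record { V = TriVert p q ; Adj = λ u v → ¬ (part u ≡ part v) }

record Orientation (G : Graph) : Set₁ where
  field
    arc      : V G → V G → Set
    arc⇒adj  : ∀ {u v} → arc u v → Adj G u v
    adj⇒arc  : ∀ {u v} → Adj G u v → arc u v ⊎ arc v u
    antisym  : ∀ {u v} → arc u v → arc v u → ⊥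

open Orientation public

data Walk {G : Graph} (O : Orientation G) : ℕ → V G → V G → Set where
  here : ∀ {u} → Walk O zero u u
  step : ∀ {n u w v} → arc O u w → Walk O n w v → Walk O (suc n) u v

DistAtMost : ∀ {G} → Orientation G → ℕ → V G → V G → Set
DistAtMost O k u v = ∃ λ n → n ≤ k × Walk O n u v

Strong : ∀ {G} → Orientation G → Set
Strong {G} O = (u v : V G) → ∃ λ n → Walk O n u v

DiamAtMost : ∀ {G} → Orientation G → ℕ → Set
DiamAtMost {G} O k = (u v : V G) → DistAtMost O k u v

OrientedDiameterIs : Graph → ℕ → Set₁
OrientedDiameterIs G d =
  (Σ (Orientation G) λ O → Strong O × DiamAtMost O d)
  × ((O : Orientation G) → Strong O → (k : ℕ) → DiamAtMost O k → d ≤ k)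

{-# OPTIONS --safe #-}
-- Write X = {x₁, x₂, x₃}, k = ⌊(p+1)/2⌋, and view {x₁} ∪ Y as a (p+1)-set W. Orient
-- x₂ → Y → x₃ → Z → x₂, let x₁ point to a k-set S ⊆ Y, and let each z ∈ Z point to a
-- k-set N z ⊆ W and receive arcs from the rest of W. Distinct sets of equal size are
-- incomparable, so two Z-vertices, or z and x₁, are joined through a point of W lying in
-- one set but not the other. If moreover the N z separate W (for u ≠ v some N z contains v
-- but not u), any two points of W are joined through Z, and the remaining pairs are handled
-- by the fixed arcs. For disjoint (k-1)-sets A ∋ x₁ and B, the sets A ∪ {x} and B ∪ {x}
-- (at most 2p of them) separate W, and since 2p ≤ q < C(p+1, k) they extend to q distinct
-- k-sets other than S. Diameter 2 is optimal because two vertices of Z are not adjacent.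
module Submission where

open import Defs
open import Data.Nat using (ℕ; zero; suc; _+_; _*_; _∸_; _/_; _≤_; _<_; z≤n; s≤s)
open import Data.Nat.Properties
  using ( ≡-irrelevant; +-comm; *-comm; +-identityʳ; ≤-refl; ≤-reflexive; ≤-trans; ≤-pred
        ; <⇒≤; <-irrefl; ≤⇒≯; <⇒≱; n≤1+n; m≤m+n; m≤n+m; m<m+n; m≤n⇒m≤1+n
        ; +-monoʳ-≤; *-monoʳ-≤; m+n≤o⇒m≤o∸n; m∸n+n≡m )
open import Data.Nat.Combinatorics using (_C_; nCk+nC[k+1]≡[n+1]C[k+1])
open import Data.Nat.DivMod using (m/n*n≤m; /-monoˡ-≤)
open import Data.Bool using (if_then_else_)
import Data.Bool as Bool
open import Data.Fin using (Fin; zero; suc; toℕ; fromℕ<; _↑ˡ_; _↑ʳ_)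
open import Data.Fin.Properties
  using (pigeonhole; <⇒≢; ¬∀⟶∃¬; any?; toℕ-fromℕ<; +↔⊎) renaming (_≟_ to _≟ᶠ_)
open import Data.Fin.Subset
  using (Subset; inside; outside; ⁅_⁆; _∪_; _∈_; _∉_; _⊆_; ∣_∣) renaming (⊥ to ∅)
open import Data.Fin.Subset.Properties
  using ( _∈?_; ⊆-antisym; p⊂q⇒∣p∣<∣q∣; ∣⊥∣≡0; ∣⁅x⁆∣≡1; x∈⁅x⁆; x∈⁅y⁆⇒x≡y
        ; x∈p∪q⁺; x∈p∪q⁻; ∪-identityʳ; drop-not-there; ∉⊥ )
open import Data.Vec using ([]; _∷_; here; there)
open import Data.Vec.Properties using (∷-injectiveʳ; ≡-dec)
import Data.Vec.Functional as Vector
open import Data.Vec.Functional.Properties using (lookup-++ˡ; lookup-++ʳ)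
open import Data.Vec.Functional.Relation.Unary.All.Properties using (++⁺)
open import Data.Empty using (⊥)
open import Data.Product using (Σ-syntax; ∃; _×_; _,_; proj₁; proj₂; map₂)
import Data.Product as Product
open import Data.Sum using (_⊎_; inj₁; inj₂; [_,_]′; swap)
import Data.Sum as Sum
open import Data.Sum.Function.Propositional using (_⊎-↣_)
open import Function using (_∘_)
open import Function.Bundles using (_↣_; mk↣; Injection)
open import Function.Construct.Composition using (_↣-∘_)
open import Function.Definitions using (Injective)
open import Function.Properties.Inverse using (↔⇒↣)
open import Relation.Nullary using (¬_; yes; no; does; contradiction)
open import Relation.Nullary.Decidable using (toSum; map′; decidable-stable; _→-dec_)
open import Relation.Nullary.Negation using (¬∃⟶∀¬)
open import Relation.Binary.Definitions using (DecidableEquality)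
open import Relation.Binary.PropositionalEquality
  using (_≡_; _≢_; refl; sym; trans; cong; subst; subst₂; module ≡-Reasoning)

private
  variable
    n : ℕ

-- Subsets of a finite set

∣p∪⁅x⁆∣≡1+∣p∣ : ∀ {x} {p : Subset n} → x ∉ p → ∣ p ∪ ⁅ x ⁆ ∣ ≡ suc ∣ p ∣
∣p∪⁅x⁆∣≡1+∣p∣ {x = zero}  {inside  ∷ p} x∉p = contradiction here x∉p
∣p∪⁅x⁆∣≡1+∣p∣ {x = zero}  {outside ∷ p} _   = cong (suc ∘ ∣_∣) (∪-identityʳ p)
∣p∪⁅x⁆∣≡1+∣p∣ {x = suc x} {inside  ∷ p} x∉p = cong suc (∣p∪⁅x⁆∣≡1+∣p∣ (drop-not-there x∉p))
∣p∪⁅x⁆∣≡1+∣p∣ {x = suc x} {outside ∷ p} x∉p = ∣p∪⁅x⁆∣≡1+∣p∣ (drop-not-there x∉p)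

∣q∣≤∣p∣∧p≢q⇒∃[x∈p∧x∉q] : {p q : Subset n} → ∣ q ∣ ≤ ∣ p ∣ → p ≢ q → ∃ λ x → x ∈ p × x ∉ q
∣q∣≤∣p∣∧p≢q⇒∃[x∈p∧x∉q] {n} {p} {q} ∣q∣≤∣p∣ p≢q =
  map₂ witness (¬∀⟶∃¬ n (λ x → x ∈ p → x ∈ q) (λ x → x ∈? p →-dec x ∈? q) (p≢q ∘ ⊆⇒≡))
  where
  ⊆⇒≡ : (∀ x → x ∈ p → x ∈ q) → p ≡ q
  ⊆⇒≡ p⊆q = ⊆-antisym (p⊆q _) q⊆p
    where
    q⊆p : q ⊆ p
    q⊆p {x} x∈q with x ∈? p
    ... | yes x∈p = x∈p
    ... | no  x∉p = contradiction (p⊂q⇒∣p∣<∣q∣ (p⊆q _ , x , x∈q , x∉p)) (≤⇒≯ ∣q∣≤∣p∣)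
  witness : ∀ {x} → ¬ (x ∈ p → x ∈ q) → x ∈ p × x ∉ q
  witness {x} x∈p⇏x∈q =
    decidable-stable (x ∈? p) (λ x∉p → x∈p⇏x∈q (λ x∈p → contradiction x∈p x∉p)) ,
    λ x∈q → x∈p⇏x∈q (λ _ → x∈q)

interval : ℕ → ℕ → Subset n
interval {zero}  _        _         = []
interval {suc n} (suc lo) len       = outside ∷ interval lo len
interval {suc n} zero     zero      = ∅
interval {suc n} zero     (suc len) = inside ∷ interval zero len

∣interval∣ : ∀ lo len → lo + len ≤ n → ∣ interval {n} lo len ∣ ≡ len
∣interval∣ {zero}  zero     zero      _              = refl
∣interval∣ {suc n} (suc lo) len       (s≤s lo+len≤n) = ∣interval∣ lo len lo+len≤n
∣interval∣ {suc n} zero     zero      _              = ∣⊥∣≡0 (suc n)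
∣interval∣ {suc n} zero     (suc len) (s≤s len≤n)    = cong suc (∣interval∣ zero len len≤n)

∈-interval⁺ : ∀ lo len {x : Fin n} → lo ≤ toℕ x → toℕ x < lo + len → x ∈ interval lo len
∈-interval⁺ zero     (suc len) {zero}  _          _           = here
∈-interval⁺ zero     (suc len) {suc x} _          (s≤s x<len) = there (∈-interval⁺ zero len z≤n x<len)
∈-interval⁺ (suc lo) len       {suc x} (s≤s lo≤x) (s≤s x<)    = there (∈-interval⁺ lo len lo≤x x<)

∈-interval⁻ : ∀ lo len {x : Fin n} → x ∈ interval lo len → lo ≤ toℕ x × toℕ x < lo + len
∈-interval⁻ {suc n} zero     zero      x∈∅        = contradiction x∈∅ ∉⊥
∈-interval⁻ {suc n} zero     (suc len) here       = z≤n , s≤s z≤n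
∈-interval⁻ {suc n} zero     (suc len) (there x∈) = Product.map (λ _ → z≤n) s≤s (∈-interval⁻ zero len x∈)
∈-interval⁻ {suc n} (suc lo) len       (there x∈) = Product.map s≤s s≤s (∈-interval⁻ lo len x∈)

adjoin : Subset n → Fin n → Fin n → Subset n
adjoin p spare x = p ∪ ⁅ if does (x ∈? p) then spare else x ⁆

adjoin-∉ : ∀ {p : Subset n} {spare x} → x ∉ p → adjoin p spare x ≡ p ∪ ⁅ x ⁆
adjoin-∉ {p = p} {x = x} x∉p with x ∈? p
... | yes x∈p = contradiction x∈p x∉p
... | no  _   = refl

adjoin-∈ : ∀ {p : Subset n} {spare x} → x ∈ p → adjoin p spare x ≡ p ∪ ⁅ spare ⁆
adjoin-∈ {p = p} {x = x} x∈p with x ∈? p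
... | yes _   = refl
... | no  x∉p = contradiction x∈p x∉p

∣adjoin∣ : ∀ {p : Subset n} {spare} x → spare ∉ p → ∣ adjoin p spare x ∣ ≡ suc ∣ p ∣
∣adjoin∣ {p = p} x spare∉p with x ∈? p
... | yes _   = ∣p∪⁅x⁆∣≡1+∣p∣ spare∉p
... | no  x∉p = ∣p∪⁅x⁆∣≡1+∣p∣ x∉p

-- Separating families

infix 4 _∋_∌_

_∋_∌_ : Subset n → Fin n → Fin n → Set
p ∋ v ∌ u = v ∈ p × u ∉ p

Separates : ∀ {m} → (Fin m → Subset n) → Set
Separates F = ∀ {u v} → u ≢ v → ∃ λ i → F i ∋ v ∌ u

separates-via-cover : ∀ {m m′} {F : Fin m → Subset n} {G : Fin m′ → Subset n} →
                      (∀ j → ∃ λ i → F i ≡ G j) → Separates G → Separates F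
separates-via-cover {F = F} covers G-separates {u} {v} u≢v with G-separates u≢v
... | j , Gj∋v∌u with covers j
... | i , Fi≡Gj = i , subst (_∋ v ∌ u) (sym Fi≡Gj) Gj∋v∌u

∪⁅⁆-separates : ∀ {p : Subset n} {u v x} → u ∉ p → u ≢ x → v ∈ p ⊎ v ≡ x → p ∪ ⁅ x ⁆ ∋ v ∌ u
∪⁅⁆-separates {p = p} {x = x} u∉p u≢x v∈p⊎v≡x =
  x∈p∪q⁺ (Sum.map₂ (λ { refl → x∈⁅x⁆ x }) v∈p⊎v≡x) ,
  [ u∉p , u≢x ∘ x∈⁅y⁆⇒x≡y x ]′ ∘ x∈p∪q⁻ p ⁅ x ⁆

module _ {A B : Subset n} (A∩B≡∅ : ∀ {x} → x ∈ A → x ∉ B)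
         {x₀} (x₀∉A : x₀ ∉ A) (x₀∉B : x₀ ∉ B) where

  separate-by-one-point-extensions : ∀ {u v} → u ≢ v →
    ∃ λ x → (x ∉ A × A ∪ ⁅ x ⁆ ∋ v ∌ u) ⊎ (x ∉ B × B ∪ ⁅ x ⁆ ∋ v ∌ u)
  separate-by-one-point-extensions {u} {v} u≢v with u ∈? A
  ... | yes u∈A with v ∈? B
  ...   | yes v∈B = x₀ , inj₂ (x₀∉B , ∪⁅⁆-separates (A∩B≡∅ u∈A) (λ { refl → x₀∉A u∈A }) (inj₁ v∈B))
  ...   | no  v∉B = v  , inj₂ (v∉B , ∪⁅⁆-separates (A∩B≡∅ u∈A) u≢v (inj₂ refl))
  separate-by-one-point-extensions {u} {v} u≢v | no u∉A with v ∈? A | u ∈? B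
  ...   | no  v∉A | _       = v  , inj₁ (v∉A , ∪⁅⁆-separates u∉A u≢v (inj₂ refl))
  ...   | yes v∈A | yes u∈B = x₀ , inj₁ (x₀∉A , ∪⁅⁆-separates u∉A (λ { refl → x₀∉B u∈B }) (inj₁ v∈A))
  ...   | yes v∈A | no  u∉B = v  , inj₂ (A∩B≡∅ v∈A , ∪⁅⁆-separates u∉B u≢v (inj₂ refl))

-- Injective families of k-subsets

KSubset : ℕ → ℕ → Set
KSubset n k = Σ[ p ∈ Subset n ] ∣ p ∣ ≡ k

KSubset-≡ : ∀ {k} {s t : KSubset n k} → proj₁ s ≡ proj₁ t → s ≡ t
KSubset-≡ {s = p , ∣p∣≡k} {t = .p , ∣p∣≡k′} refl = cong (p ,_) (≡-irrelevant ∣p∣≡k ∣p∣≡k′)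

_≟ₖ_ : ∀ {k} → DecidableEquality (KSubset n k)
s ≟ₖ t = map′ KSubset-≡ (cong proj₁) (≡-dec Bool._≟_ (proj₁ s) (proj₁ t))

choose : ∀ n k → Fin (n C k) ↣ KSubset n k
choose n       zero    = mk↣ {to = λ _ → ∅ , ∣⊥∣≡0 n} λ { {zero} {zero} _ → refl }
choose zero    (suc k) = mk↣ {to = λ ()} λ { {()} }
choose (suc n) (suc k) =
  subst (λ m → Fin m ↣ KSubset (suc n) (suc k)) (nCk+nC[k+1]≡[n+1]C[k+1] n k)
    (cons ↣-∘ ((choose n k ⊎-↣ choose n (suc k)) ↣-∘ ↔⇒↣ +↔⊎))
  where
  cons : (KSubset n k ⊎ KSubset n (suc k)) ↣ KSubset (suc n) (suc k)
  cons = mk↣ {to = to} injective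
    where
    to : KSubset n k ⊎ KSubset n (suc k) → KSubset (suc n) (suc k)
    to (inj₁ (p , ∣p∣≡k))   = inside  ∷ p , cong suc ∣p∣≡k
    to (inj₂ (p , ∣p∣≡1+k)) = outside ∷ p , ∣p∣≡1+k
    injective : Injective _≡_ _≡_ to
    injective {inj₁ _} {inj₁ _} eq = cong inj₁ (KSubset-≡ (∷-injectiveʳ (cong proj₁ eq)))
    injective {inj₂ _} {inj₂ _} eq = cong inj₂ (KSubset-≡ (∷-injectiveʳ (cong proj₁ eq)))
    injective {inj₁ _} {inj₂ _} ()
    injective {inj₂ _} {inj₁ _} ()

∷-injective : ∀ {A : Set} {m x} {F : Fin m → A} →
              (∀ i → F i ≢ x) → Injective _≡_ _≡_ F → Injective _≡_ _≡_ (x Vector.∷ F)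
∷-injective x∉F F-injective {zero}  {zero}  _  = refl
∷-injective x∉F F-injective {zero}  {suc j} eq = contradiction (sym eq) (x∉F j)
∷-injective x∉F F-injective {suc i} {zero}  eq = contradiction eq (x∉F i)
∷-injective x∉F F-injective {suc i} {suc j} eq = cong suc (F-injective eq)

module _ {A : Set} (_≟_ : DecidableEquality A) where

  open Injection using (to; injective)

  value-outside-image : ∀ {m N} (f : Fin N ↣ A) (g : Fin m → A) → m < N →
                        ∃ λ i → ∀ j → g j ≢ to f i
  value-outside-image {m} {N} f g m<N =
    map₂ ¬∃⟶∀¬ (¬∀⟶∃¬ N (λ i → ∃ λ j → g j ≡ to f i) (λ i → any? λ j → g j ≟ to f i) uncovered)
    where
    uncovered : ¬ (∀ i → ∃ λ j → g j ≡ to f i)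
    uncovered covered with pigeonhole m<N (proj₁ ∘ covered)
    ... | i , i′ , i<i′ , same = <⇒≢ i<i′ (injective f (begin
      to f i                 ≡⟨ sym (proj₂ (covered i)) ⟩
      g (proj₁ (covered i))  ≡⟨ cong g same ⟩
      g (proj₁ (covered i′)) ≡⟨ proj₂ (covered i′) ⟩
      to f i′                ∎))
      where open ≡-Reasoning

  module _ {N} (f : Fin N ↣ A) (bad : A) where

    Selection : ℕ → Set
    Selection q = Σ[ F ∈ (Fin q → A) ] Injective _≡_ _≡_ F × (∀ i → F i ≢ bad)

    extend : ∀ {m x} ((F , _) : Selection m) → x ≢ bad → (∀ i → F i ≢ x) → Selection (suc m)
    extend {x = x} (F , F-injective , F≢bad) x≢bad x∉F =
      x Vector.∷ F , ∷-injective x∉F F-injective , λ { zero → x≢bad ; (suc i) → F≢bad i }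

    extend-fresh : ∀ {m} → suc m < N → Selection m → Selection (suc m)
    extend-fresh 1+m<N S@(F , _) with value-outside-image f (bad Vector.∷ F) 1+m<N
    ... | _ , new = extend S (new zero ∘ sym) (new ∘ suc)

    shift : ∀ {m x y} {F : Fin m → A} → (∃ λ i → F i ≡ y) → ∃ λ i → (x Vector.∷ F) i ≡ y
    shift (i , Fi≡y) = suc i , Fi≡y

    select : ∀ {g q} (G : Fin g → A) → (∀ j → G j ≢ bad) → g ≤ q → q < N →
             Σ[ (F , _) ∈ Selection q ] (∀ j → ∃ λ i → F i ≡ G j)
    select {q = zero}  G _ z≤n _ = ((λ ()) , (λ { {()} }) , λ ()) , λ ()
    select {q = suc q} G G≢bad z≤n q<N with select G G≢bad z≤n (<⇒≤ q<N)
    ... | S , covers = extend-fresh q<N S , shift ∘ covers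
    select {q = suc q} G G≢bad (s≤s g≤q) q<N with select (G ∘ suc) (G≢bad ∘ suc) g≤q (<⇒≤ q<N)
    ... | S@(F , _) , covers with any? (λ i → F i ≟ G zero)
    ...   | yes G₀∈F = extend-fresh q<N S , λ { zero → shift G₀∈F ; (suc j) → shift (covers j) }
    ...   | no  G₀∉F = extend S (G≢bad zero) (¬∃⟶∀¬ G₀∉F) ,
                       λ { zero → zero , refl ; (suc j) → shift (covers j) }

-- A point of Fin (suc p) stands for x₁ (zero) or for a vertex y of Y (suc y). S is the
-- out-neighbourhood of x₁ in Y and N z the out-neighbourhood of z in {x₁} ∪ Y.
record OutNeighbourhoods (p q k : ℕ) : Set where
  field
    S           : Subset (suc p)
    ∣S∣         : ∣ S ∣ ≡ k
    zero∉S      : zero ∉ S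
    y₀          : Fin p
    suc-y₀∉S    : suc y₀ ∉ S
    N           : Fin q → Subset (suc p)
    ∣N∣         : ∀ z → ∣ N z ∣ ≡ k
    N-injective : Injective _≡_ _≡_ N
    N≢S         : ∀ z → N z ≢ S
    N-separates : Separates N

module Construction {p q κ : ℕ} (2k≤1+p : 2 * suc (suc κ) ≤ suc p) where

  k′ k : ℕ
  k′ = suc κ
  k  = suc k′

  k′+k≤p : k′ + k ≤ p
  k′+k≤p = ≤-pred (subst (_≤ suc p) (cong (k +_) (+-identityʳ k)) 2k≤1+p)

  k′+k′<1+p : k′ + k′ < suc p
  k′+k′<1+p = s≤s (≤-trans (+-monoʳ-≤ k′ (n≤1+n k′)) k′+k≤p)

  κ<p : κ < p
  κ<p = ≤-trans (m≤m+n k′ k) k′+k≤p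

  k′<1+p∸k : k′ < suc p ∸ k
  k′<1+p∸k = m+n≤o⇒m≤o∸n (suc k′) (s≤s k′+k≤p)

  A B S : Subset (suc p)
  A = interval 0 k′
  B = interval k′ k′
  S = interval (suc p ∸ k) k

  x₀ : Fin (suc p)
  x₀ = fromℕ< k′+k′<1+p

  β : Fin p
  β = fromℕ< κ<p

  ∣A∣ : ∣ A ∣ ≡ k′
  ∣A∣ = ∣interval∣ 0 k′ (≤-trans (m≤m+n k′ k′) (<⇒≤ k′+k′<1+p))

  ∣B∣ : ∣ B ∣ ≡ k′
  ∣B∣ = ∣interval∣ k′ k′ (<⇒≤ k′+k′<1+p)

  ∣S∣ : ∣ S ∣ ≡ k
  ∣S∣ = ∣interval∣ (suc p ∸ k) k (≤-reflexive (m∸n+n≡m (m≤n⇒m≤1+n (≤-trans (m≤n+m k k′) k′+k≤p))))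

  toℕ-x₀ : toℕ x₀ ≡ k′ + k′
  toℕ-x₀ = toℕ-fromℕ< k′+k′<1+p

  toℕ-suc-β : toℕ (suc β) ≡ k′
  toℕ-suc-β = cong suc (toℕ-fromℕ< κ<p)

  zero∈A : zero ∈ A
  zero∈A = ∈-interval⁺ 0 k′ z≤n (s≤s z≤n)

  zero∉B : zero ∉ B
  zero∉B zero∈B = contradiction (proj₁ (∈-interval⁻ k′ k′ zero∈B)) λ ()

  suc-β∈B : suc β ∈ B
  suc-β∈B = ∈-interval⁺ k′ k′ (≤-reflexive (sym toℕ-suc-β))
              (subst (_< k′ + k′) (sym toℕ-suc-β) (m<m+n k′ (s≤s z≤n)))

  A∩B≡∅ : ∀ {x} → x ∈ A → x ∉ B
  A∩B≡∅ x∈A x∈B = <⇒≱ (proj₂ (∈-interval⁻ 0 k′ x∈A)) (proj₁ (∈-interval⁻ k′ k′ x∈B))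

  x₀∉A : x₀ ∉ A
  x₀∉A x₀∈A = <⇒≱ (proj₂ (∈-interval⁻ 0 k′ x₀∈A)) (subst (k′ ≤_) (sym toℕ-x₀) (m≤m+n k′ k′))

  x₀∉B : x₀ ∉ B
  x₀∉B x₀∈B = <-irrefl toℕ-x₀ (proj₂ (∈-interval⁻ k′ k′ x₀∈B))

  small∉S : ∀ {x} → toℕ x ≤ k′ → x ∉ S
  small∉S x≤k′ x∈S = <⇒≱ k′<1+p∸k (≤-trans (proj₁ (∈-interval⁻ (suc p ∸ k) k x∈S)) x≤k′)

  zero∉S : zero ∉ S
  zero∉S = small∉S z≤n

  suc-β∉S : suc β ∉ S
  suc-β∉S = small∉S (≤-reflexive toℕ-suc-β)

  A-gadget B-gadget : Fin p → KSubset (suc p) k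
  A-gadget y = adjoin A x₀ (suc y) , trans (∣adjoin∣ (suc y) x₀∉A) (cong suc ∣A∣)
  B-gadget y = adjoin B zero (suc y) , trans (∣adjoin∣ (suc y) zero∉B) (cong suc ∣B∣)

  -- Indexing by Y suffices: A ∪ ⁅ x ⁆ with x ∉ A never has x = zero as zero ∈ A, and
  -- B ∪ ⁅ zero ⁆ is B-gadget β because suc β ∈ B.
  gadget : Fin (p + p) → KSubset (suc p) k
  gadget = A-gadget Vector.++ B-gadget

  gadget≢S : ∀ j → gadget j ≢ (S , ∣S∣)
  gadget≢S = ++⁺ (_≢ (S , ∣S∣)) {xs = A-gadget} {ys = B-gadget}
    (λ _ eq → zero∉S  (subst (zero ∈_)  (cong proj₁ eq) (x∈p∪q⁺ (inj₁ zero∈A))))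
    (λ _ eq → suc-β∉S (subst (suc β ∈_) (cong proj₁ eq) (x∈p∪q⁺ (inj₁ suc-β∈B))))

  A-extension : ∀ {x} → x ∉ A → ∃ λ j → proj₁ (gadget j) ≡ A ∪ ⁅ x ⁆
  A-extension {zero}  zero∉A = contradiction zero∈A zero∉A
  A-extension {suc y} y∉A    = y ↑ˡ p , trans (cong proj₁ (lookup-++ˡ A-gadget B-gadget y)) (adjoin-∉ y∉A)

  B-extension : ∀ {x} → x ∉ B → ∃ λ j → proj₁ (gadget j) ≡ B ∪ ⁅ x ⁆
  B-extension {zero}  _   = p ↑ʳ β , trans (cong proj₁ (lookup-++ʳ A-gadget B-gadget β)) (adjoin-∈ suc-β∈B)
  B-extension {suc y} y∉B = p ↑ʳ y , trans (cong proj₁ (lookup-++ʳ A-gadget B-gadget y)) (adjoin-∉ y∉B)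

  gadgets-separate : Separates (proj₁ ∘ gadget)
  gadgets-separate {u} {v} u≢v with separate-by-one-point-extensions A∩B≡∅ x₀∉A x₀∉B u≢v
  ... | _ , inj₁ (x∉A , sep) = map₂ (λ eq → subst (_∋ v ∌ u) (sym eq) sep) (A-extension x∉A)
  ... | _ , inj₂ (x∉B , sep) = map₂ (λ eq → subst (_∋ v ∌ u) (sym eq) sep) (B-extension x∉B)

  out-neighbourhoods : 2 * p ≤ q → q < suc p C k → OutNeighbourhoods p q k
  out-neighbourhoods 2p≤q q<C
    with select _≟ₖ_ (choose (suc p) k) (S , ∣S∣) gadget gadget≢S p+p≤q q<C
    where p+p≤q = subst (_≤ q) (cong (p +_) (+-identityʳ p)) 2p≤q
  ... | (F , F-injective , F≢S) , covers = record
    { S           = S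
    ; ∣S∣         = ∣S∣
    ; zero∉S      = zero∉S
    ; y₀          = β
    ; suc-y₀∉S    = suc-β∉S
    ; N           = proj₁ ∘ F
    ; ∣N∣         = proj₂ ∘ F
    ; N-injective = F-injective ∘ KSubset-≡
    ; N≢S         = λ z → F≢S z ∘ KSubset-≡
    ; N-separates = separates-via-cover (map₂ (cong proj₁) ∘ covers) gadgets-separate
    }

-- The orientation

pattern x₁  = inj₁ zero
pattern x₂  = inj₁ (suc zero)
pattern x₃  = inj₁ (suc (suc zero))
pattern Y y = inj₂ (inj₁ y)
pattern Z z = inj₂ (inj₂ z)

module DiameterTwo {p q k : ℕ} (2≤k : 2 ≤ k) (𝒩 : OutNeighbourhoods p q k) where

  open OutNeighbourhoods 𝒩

  W : Fin (suc p) → TriVert p q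
  W zero    = x₁
  W (suc y) = Y y

  infix 4 _⟶_

  data _⟶_ : TriVert p q → TriVert p q → Set where
    x₁⟶y : ∀ {y} → suc y ∈ S → x₁ ⟶ Y y
    y⟶x₁ : ∀ {y} → suc y ∉ S → Y y ⟶ x₁
    x₂⟶y : ∀ {y} → x₂ ⟶ Y y
    y⟶x₃ : ∀ {y} → Y y ⟶ x₃
    z⟶x₁ : ∀ {z} → zero ∈ N z → Z z ⟶ x₁
    x₁⟶z : ∀ {z} → zero ∉ N z → x₁ ⟶ Z z
    z⟶x₂ : ∀ {z} → Z z ⟶ x₂
    x₃⟶z : ∀ {z} → x₃ ⟶ Z z
    z⟶y  : ∀ {y z} → suc y ∈ N z → Z z ⟶ Y y
    y⟶z  : ∀ {y z} → suc y ∉ N z → Y y ⟶ Z z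

  ⟶-crosses-parts : ∀ {u v} → u ⟶ v → part u ≢ part v
  ⟶-crosses-parts (x₁⟶y _) ()
  ⟶-crosses-parts (y⟶x₁ _) ()
  ⟶-crosses-parts x₂⟶y     ()
  ⟶-crosses-parts y⟶x₃     ()
  ⟶-crosses-parts (z⟶x₁ _) ()
  ⟶-crosses-parts (x₁⟶z _) ()
  ⟶-crosses-parts z⟶x₂     ()
  ⟶-crosses-parts x₃⟶z     ()
  ⟶-crosses-parts (z⟶y _)  ()
  ⟶-crosses-parts (y⟶z _)  ()

  ⟶-asym : ∀ {u v} → u ⟶ v → v ⟶ u → ⊥
  ⟶-asym (x₁⟶y y∈S)  (y⟶x₁ y∉S)  = y∉S y∈S
  ⟶-asym (y⟶x₁ y∉S)  (x₁⟶y y∈S)  = y∉S y∈S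
  ⟶-asym (z⟶x₁ 0∈N) (x₁⟶z 0∉N) = 0∉N 0∈N
  ⟶-asym (x₁⟶z 0∉N) (z⟶x₁ 0∈N) = 0∉N 0∈N
  ⟶-asym (z⟶y y∈N)  (y⟶z y∉N)  = y∉N y∈N
  ⟶-asym (y⟶z y∉N)  (z⟶y y∈N)  = y∉N y∈N

  orient-XY : ∀ x y → inj₁ x ⟶ Y y ⊎ Y y ⟶ inj₁ x
  orient-XY zero             y = Sum.map x₁⟶y y⟶x₁ (toSum (suc y ∈? S))
  orient-XY (suc zero)       y = inj₁ x₂⟶y
  orient-XY (suc (suc zero)) y = inj₂ y⟶x₃

  orient-XZ : ∀ x z → inj₁ x ⟶ Z z ⊎ Z z ⟶ inj₁ x
  orient-XZ zero             z = swap (Sum.map z⟶x₁ x₁⟶z (toSum (zero ∈? N z)))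
  orient-XZ (suc zero)       z = inj₂ z⟶x₂
  orient-XZ (suc (suc zero)) z = inj₁ x₃⟶z

  orient-YZ : ∀ y z → Y y ⟶ Z z ⊎ Z z ⟶ Y y
  orient-YZ y z = swap (Sum.map z⟶y y⟶z (toSum (suc y ∈? N z)))

  orient : ∀ u v → part u ≢ part v → u ⟶ v ⊎ v ⟶ u
  orient (inj₁ _) (inj₁ _) ≢ = contradiction refl ≢
  orient (inj₁ x) (Y y)    _ = orient-XY x y
  orient (inj₁ x) (Z z)    _ = orient-XZ x z
  orient (Y y)    (inj₁ x) _ = swap (orient-XY x y)
  orient (Y _)    (Y _)    ≢ = contradiction refl ≢
  orient (Y y)    (Z z)    _ = orient-YZ y z
  orient (Z z)    (inj₁ x) _ = swap (orient-XZ x z)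
  orient (Z z)    (Y y)    _ = swap (orient-YZ y z)
  orient (Z _)    (Z _)    ≢ = contradiction refl ≢

  O : Orientation (K3 p q)
  O = record
    { arc     = _⟶_
    ; arc⇒adj = ⟶-crosses-parts
    ; adj⇒arc = orient _ _
    ; antisym = ⟶-asym
    }

  infix 4 _⇝_

  _⇝_ : TriVert p q → TriVert p q → Set
  u ⇝ v = DistAtMost O 2 u v

  zero-steps : ∀ {u} → u ⇝ u
  zero-steps = 0 , z≤n , here

  one-step : ∀ {u v} → u ⟶ v → u ⇝ v
  one-step u⟶v = 1 , s≤s z≤n , step u⟶v here

  two-steps : ∀ {u w v} → u ⟶ w → w ⟶ v → u ⇝ v
  two-steps u⟶w w⟶v = 2 , ≤-refl , step u⟶w (step w⟶v here)

  z⟶W : ∀ {z} x → x ∈ N z → Z z ⟶ W x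
  z⟶W zero    = z⟶x₁
  z⟶W (suc _) = z⟶y

  W⟶z : ∀ {z} x → x ∉ N z → W x ⟶ Z z
  W⟶z zero    = x₁⟶z
  W⟶z (suc _) = y⟶z

  partner : Fin (suc p) → Fin (suc p)
  partner zero    = suc y₀
  partner (suc _) = zero

  partner≢ : ∀ x → x ≢ partner x
  partner≢ zero    ()
  partner≢ (suc _) ()

  avoiding : ∀ x → ∃ λ z → x ∉ N z
  avoiding x = map₂ proj₂ (N-separates (partner≢ x))

  containing : ∀ x → ∃ λ z → x ∈ N z
  containing x = map₂ proj₁ (N-separates (partner≢ x ∘ sym))

  suc-difference : ∀ {P Q : Subset (suc p)} → zero ∉ P ⊎ zero ∈ Q → ∣ Q ∣ ≤ ∣ P ∣ → P ≢ Q →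
                   ∃ λ y → suc y ∈ P × suc y ∉ Q
  suc-difference zero∉P⊎zero∈Q ∣Q∣≤∣P∣ P≢Q with ∣q∣≤∣p∣∧p≢q⇒∃[x∈p∧x∉q] ∣Q∣≤∣P∣ P≢Q
  ... | suc y , y∈P , y∉Q = y , y∈P , y∉Q
  ... | zero  , 0∈P , 0∉Q = contradiction zero∉P⊎zero∈Q [ (λ 0∉P → 0∉P 0∈P) , 0∉Q ]′

  S∖N : ∀ z → ∃ λ y → suc y ∈ S × suc y ∉ N z
  S∖N z = suc-difference (inj₁ zero∉S) (≤-reflexive (trans (∣N∣ z) (sym ∣S∣))) (N≢S z ∘ sym)

  N∖S : ∀ z → zero ∉ N z → ∃ λ y → suc y ∈ N z × suc y ∉ S
  N∖S z zero∉N = suc-difference (inj₁ zero∉N) (≤-reflexive (trans ∣S∣ (sym (∣N∣ z)))) (N≢S z)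

  N∖⁅zero⁆ : ∀ z → ∃ λ y → suc y ∈ N z
  N∖⁅zero⁆ z = map₂ proj₁ (suc-difference (inj₂ (x∈⁅x⁆ zero)) ∣⁅0⁆∣≤∣N∣ N≢⁅0⁆)
    where
    ⁅0⁆ : Subset (suc p)
    ⁅0⁆ = ⁅ zero ⁆
    ∣⁅0⁆∣≡1 : ∣ ⁅0⁆ ∣ ≡ 1
    ∣⁅0⁆∣≡1 = ∣⁅x⁆∣≡1 {n = suc p} zero
    ∣⁅0⁆∣≤∣N∣ : ∣ ⁅0⁆ ∣ ≤ ∣ N z ∣
    ∣⁅0⁆∣≤∣N∣ = subst₂ _≤_ (sym ∣⁅0⁆∣≡1) (sym (∣N∣ z)) (≤-trans (s≤s z≤n) 2≤k)
    N≢⁅0⁆ : N z ≢ ⁅0⁆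
    N≢⁅0⁆ eq = <-irrefl (trans (sym ∣⁅0⁆∣≡1) (trans (cong ∣_∣ (sym eq)) (∣N∣ z))) 2≤k

  S∖∅ : ∃ λ y → suc y ∈ S
  S∖∅ = map₂ proj₁ (suc-difference (inj₁ zero∉S) (subst (_≤ ∣ S ∣) (sym ∣∅∣≡0) z≤n) S≢∅)
    where
    ∣∅∣≡0 : ∣ ∅ {n = suc p} ∣ ≡ 0
    ∣∅∣≡0 = ∣⊥∣≡0 (suc p)
    S≢∅ : S ≢ ∅
    S≢∅ eq = <-irrefl (trans (sym ∣∅∣≡0) (trans (cong ∣_∣ (sym eq)) ∣S∣)) (≤-trans (s≤s z≤n) 2≤k)

  W⇝W : ∀ u v → W u ⇝ W v
  W⇝W u v with u ≟ᶠ v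
  ... | yes refl = zero-steps
  ... | no  u≢v  with N-separates u≢v
  ...   | _ , v∈N , u∉N = two-steps (W⟶z u u∉N) (z⟶W v v∈N)

  W⇝x₂ : ∀ x → W x ⇝ x₂
  W⇝x₂ x with avoiding x
  ... | _ , x∉N = two-steps (W⟶z x x∉N) z⟶x₂

  x₃⇝W : ∀ x → x₃ ⇝ W x
  x₃⇝W x with containing x
  ... | _ , x∈N = two-steps x₃⟶z (z⟶W x x∈N)

  Z⇝Z : ∀ z z′ → Z z ⇝ Z z′
  Z⇝Z z z′ with z ≟ᶠ z′
  ... | yes refl = zero-steps
  ... | no  z≢z′
    with ∣q∣≤∣p∣∧p≢q⇒∃[x∈p∧x∉q] (≤-reflexive (trans (∣N∣ z′) (sym (∣N∣ z)))) (z≢z′ ∘ N-injective)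
  ...   | x , x∈N , x∉N′ = two-steps (z⟶W x x∈N) (W⟶z x x∉N′)

  x₁⇝Z : ∀ z → x₁ ⇝ Z z
  x₁⇝Z z with zero ∈? N z
  ... | no  zero∉N = one-step (x₁⟶z zero∉N)
  ... | yes _ with S∖N z
  ...   | _ , y∈S , y∉N = two-steps (x₁⟶y y∈S) (y⟶z y∉N)

  Z⇝x₁ : ∀ z → Z z ⇝ x₁
  Z⇝x₁ z with zero ∈? N z
  ... | yes zero∈N = one-step (z⟶x₁ zero∈N)
  ... | no  zero∉N with N∖S z zero∉N
  ...   | _ , y∈N , y∉S = two-steps (z⟶y y∈N) (y⟶x₁ y∉S)

  x₂⇝Z : ∀ z → x₂ ⇝ Z z
  x₂⇝Z z with S∖N z
  ... | _ , _ , y∉N = two-steps x₂⟶y (y⟶z y∉N)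

  Z⇝x₃ : ∀ z → Z z ⇝ x₃
  Z⇝x₃ z with N∖⁅zero⁆ z
  ... | _ , y∈N = two-steps (z⟶y y∈N) y⟶x₃

  x₁⇝x₃ : x₁ ⇝ x₃
  x₁⇝x₃ with S∖∅
  ... | _ , y∈S = two-steps (x₁⟶y y∈S) y⟶x₃

  Y⇝Z : ∀ y z → Y y ⇝ Z z
  Y⇝Z y z with suc y ∈? N z
  ... | no  y∉N = one-step (y⟶z y∉N)
  ... | yes _   = two-steps y⟶x₃ x₃⟶z

  Z⇝Y : ∀ z y → Z z ⇝ Y y
  Z⇝Y z y with suc y ∈? N z
  ... | yes y∈N = one-step (z⟶y y∈N)
  ... | no  _   = two-steps z⟶x₂ x₂⟶y

  diameter≤2 : DiamAtMost O 2
  diameter≤2 x₁    x₁     = zero-steps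
  diameter≤2 x₁    x₂     = W⇝x₂ zero
  diameter≤2 x₁    x₃     = x₁⇝x₃
  diameter≤2 x₂    x₁     = two-steps (x₂⟶y {y₀}) (y⟶x₁ suc-y₀∉S)
  diameter≤2 x₂    x₂     = zero-steps
  diameter≤2 x₂    x₃     = two-steps (x₂⟶y {y₀}) y⟶x₃
  diameter≤2 x₃    x₁     = x₃⇝W zero
  diameter≤2 x₃    x₂     = two-steps (x₃⟶z {proj₁ (avoiding zero)}) z⟶x₂
  diameter≤2 x₃    x₃     = zero-steps
  diameter≤2 x₁    (Y y)  = W⇝W zero (suc y)
  diameter≤2 x₂    (Y y)  = one-step x₂⟶y
  diameter≤2 x₃    (Y y)  = x₃⇝W (suc y)
  diameter≤2 (Y y) x₁     = W⇝W (suc y) zero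
  diameter≤2 (Y y) x₂     = W⇝x₂ (suc y)
  diameter≤2 (Y y) x₃     = one-step y⟶x₃
  diameter≤2 x₁    (Z z)  = x₁⇝Z z
  diameter≤2 x₂    (Z z)  = x₂⇝Z z
  diameter≤2 x₃    (Z z)  = one-step x₃⟶z
  diameter≤2 (Z z) x₁     = Z⇝x₁ z
  diameter≤2 (Z z) x₂     = one-step z⟶x₂
  diameter≤2 (Z z) x₃     = Z⇝x₃ z
  diameter≤2 (Y y) (Y y′) = W⇝W (suc y) (suc y′)
  diameter≤2 (Y y) (Z z)  = Y⇝Z y z
  diameter≤2 (Z z) (Y y)  = Z⇝Y z y
  diameter≤2 (Z z) (Z z′) = Z⇝Z z z′

  strong : Strong O
  strong u v = map₂ proj₂ (diameter≤2 u v)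

nonadjacent-walk-length≥2 : ∀ {G} {O : Orientation G} {u v n} →
                            u ≢ v → ¬ Adj G u v → Walk O n u v → 2 ≤ n
nonadjacent-walk-length≥2 u≢v _ here = contradiction refl u≢v
nonadjacent-walk-length≥2 {O = O} _ u≁v (step u⟶v here) = contradiction (arc⇒adj O u⟶v) u≁v
nonadjacent-walk-length≥2 _ _ (step _ (step _ _)) = s≤s (s≤s z≤n)

diameter≥2 : ∀ {p q} → 2 ≤ q → (O : Orientation (K3 p q)) → Strong O → ∀ k → DiamAtMost O k → 2 ≤ k
diameter≥2 (s≤s (s≤s _)) O _ k diam with diam (Z zero) (Z (suc zero))
... | _ , n≤k , walk = ≤-trans (nonadjacent-walk-length≥2 (λ ()) (λ z~z′ → z~z′ refl) walk) n≤k

oriented-diameter-two : ∀ {p q k} → 2 ≤ k → 2 * k ≤ suc p → 2 * p ≤ q → q < suc p C k →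
                        OrientedDiameterIs (K3 p q) 2
oriented-diameter-two {p} {q} 2≤k@(s≤s (s≤s z≤n)) 2k≤1+p 2p≤q q<C =
  (O , strong , diameter≤2) , diameter≥2 2≤q
  where
  open DiameterTwo 2≤k (Construction.out-neighbourhoods 2k≤1+p 2p≤q q<C)
  2≤q : 2 ≤ q
  2≤q = ≤-trans (*-monoʳ-≤ 2 (≤-trans (s≤s z≤n) (≤-pred 2k≤1+p))) 2p≤q

theorem5p4 : (p q : ℕ) → 5 ≤ p → 2 * p ≤ q → q ≤ ((p + 1) C ((p + 1) / 2)) ∸ 1
    → OrientedDiameterIs (K3 p q) 2
theorem5p4 p q 5≤p 2p≤q q≤C∸1 = oriented-diameter-two 2≤k 2k≤1+p 2p≤q q<C
  where
  k = (p + 1) / 2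
  p+1≡1+p : p + 1 ≡ suc p
  p+1≡1+p = +-comm p 1
  2≤k : 2 ≤ k
  2≤k = /-monoˡ-≤ 2 (≤-trans (≤-trans (s≤s (s≤s (s≤s (s≤s z≤n)))) 5≤p) (m≤m+n p 1))
  2k≤1+p : 2 * k ≤ suc p
  2k≤1+p = subst₂ _≤_ (*-comm k 2) p+1≡1+p (m/n*n≤m (p + 1) 2)
  q<C : q < suc p C k
  q<C = subst (λ m → q < m C k) p+1≡1+p (≤∸1⇒< ((p + 1) C k) 0<q q≤C∸1)
    where
    0<q : 0 < q
    0<q = ≤-trans (≤-trans (s≤s z≤n) 5≤p) (≤-trans (m≤m+n p (p + 0)) 2p≤q)
    ≤∸1⇒< : ∀ {m} n → 0 < m → m ≤ n ∸ 1 → m < n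
    ≤∸1⇒< (suc n) _   m≤n = s≤s m≤n
    ≤∸1⇒< zero    0<m m≤0 = contradiction (≤-trans 0<m m≤0) λ ()
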